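{- Let $T$ be a permutation tableau and consider its alternative representation. A column of $T$ is unrestricted if and only if there is no arrow (up arrow or left arrow) located strictly to the northwest of the up arrow in that column, i.e. no arrow lying in a row strictly above and a column strictly to the left of that up arrow.
   Context: A permutation tableau is a filling of a Ferrers diagram (empty rows allowed; rows top to bottom, columns left to right) with 0's and 1's such that every column contains at least one 1, and no 0 has both a 1 above it in its column and a 1 to its left in its row. A topmost 1 is the highest 1 in its column. A 0 is restricted if it has a 1 above it in the same column; a rightmost restricted 0 is the rightmost restricted 0 in its row. A 0 is c-restricted if it has a 1 to its left in the same row; a column is unrestricted if it contains no c-restricted 0. The alternative representation of $T$ is the filling of the same diagram obtained by replacing each topmost 1 by an up arrow, each rightmost restricted 0 by a left arrow, and leaving all other cells empty. -}

module Defs where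

open import Data.Nat using (ℕ; _≤_; _<_)
open import Data.Bool using (Bool; true; false)
open import Data.Product using (_×_; ∃; ∃-syntax)
open import Data.Sum using (_⊎_)
open import Data.Empty using (⊥)
open import Relation.Nullary using (¬_)
open import Relation.Binary.PropositionalEquality using (_≡_)

-- A Ferrers diagram (English convention): rows indexed 0,1,…,nrows-1 from top
-- to bottom, columns indexed 0,1,… from left to right; row i has len i cells
-- (empty rows allowed), row lengths weakly decrease going down.
record Ferrers : Set where
  field
    nrows    : ℕ
    len      : ℕ → ℕ
    len-mono : ∀ {i j} → i ≤ j → len j ≤ len i
    len-out  : ∀ {i} → nrows ≤ i → len i ≡ 0

  Cell : ℕ → ℕ → Set
  Cell i j = i < nrows × j < len i

  ncols : ℕ
  ncols = len 0

open Ferrers public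

-- A 0/1 filling of a Ferrers diagram (true = 1, false = 0); values outside
-- the diagram are irrelevant.
record Filling : Set where
  field
    shape : Ferrers
    fill  : ℕ → ℕ → Bool

open Filling public

module _ (T : Filling) where
  private
    D = shape T
    f = fill T

  OneAbove : ℕ → ℕ → Set
  OneAbove i j = ∃[ i' ] (i' < i × f i' j ≡ true)

  OneLeft : ℕ → ℕ → Set
  OneLeft i j = ∃[ j' ] (j' < j × f i j' ≡ true)

  record IsPermutationTableau : Set where
    field
      column-has-one : ∀ j → j < ncols D → ∃[ i ] (Cell D i j × f i j ≡ true)
      no-bad-zero    : ∀ i j → Cell D i j → f i j ≡ false →
                       OneAbove i j → OneLeft i j → ⊥

  TopmostOne : ℕ → ℕ → Set
  TopmostOne i j = Cell D i j × f i j ≡ true × (∀ i' → i' < i → f i' j ≡ false)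

  RestrictedZero : ℕ → ℕ → Set
  RestrictedZero i j = Cell D i j × f i j ≡ false × OneAbove i j

  RightmostRestrictedZero : ℕ → ℕ → Set
  RightmostRestrictedZero i j =
    RestrictedZero i j × (∀ j' → j < j' → ¬ RestrictedZero i j')

  CRestrictedZero : ℕ → ℕ → Set
  CRestrictedZero i j = Cell D i j × f i j ≡ false × OneLeft i j

  UnrestrictedColumn : ℕ → Set
  UnrestrictedColumn j = j < ncols D × (∀ i → ¬ CRestrictedZero i j)

  UpArrow : ℕ → ℕ → Set
  UpArrow = TopmostOne

  LeftArrow : ℕ → ℕ → Set
  LeftArrow = RightmostRestrictedZero

  Arrow : ℕ → ℕ → Set
  Arrow i j = UpArrow i j ⊎ LeftArrow i j

  ArrowNorthwestOf : ℕ → ℕ → Set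
  ArrowNorthwestOf i j = ∃[ i' ] ∃[ j' ] (i' < i × j' < j × Arrow i' j')

-- Above the up arrow of column j every cell of column j is 0, and below it the
-- tableau condition forbids a 0 with a 1 to its left. So the c-restricted 0's of
-- column j are exactly the cells (r , j) with r < i and a 1 to the left of them.
-- Such a row r exists iff some arrow lies northwest of (i , j): the topmost 1 of
-- the column of that 1 is an up arrow, and conversely every arrow sits at or
-- below a 1 of its own column.
module Submission where

open import Defs
open import Data.Nat using (ℕ; zero; suc; _≤_; _<_; s≤s; z≤n)
open import Data.Nat.Properties
  using (≤-refl; <-≤-trans; ≤-<-trans; <-trans; <⇒≤; <-cmp)
open import Data.Bool using (Bool; true; false)
open import Data.Product using (_×_; _,_; ∃-syntax)
open import Data.Sum using (inj₁; inj₂)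
open import Data.Empty using (⊥-elim)
open import Relation.Nullary using (¬_)
open import Relation.Binary using (tri<; tri≈; tri>)
open import Relation.Binary.PropositionalEquality using (_≡_; refl; trans; sym)
open import Function.Base using (_∘_)
open import Function.Bundles using (_⇔_; mk⇔; Equivalence)

∃-least-true : (g : ℕ → Bool) (n : ℕ) → g n ≡ true →
               ∃[ k ] (k ≤ n × g k ≡ true × (∀ k′ → k′ < k → g k′ ≡ false))
∃-least-true g zero    gn = zero , z≤n , gn , λ _ ()
∃-least-true g (suc n) gn with g zero in g0
... | true  = zero , z≤n , g0 , λ _ ()
... | false with ∃-least-true (g ∘ suc) n gn
...   | k , k≤n , gk , below = suc k , s≤s k≤n , gk , below′
  where
  below′ : ∀ k′ → k′ < suc k → g k′ ≡ false
  below′ zero     _           = g0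
  below′ (suc k′) (s≤s k′<k) = below k′ k′<k

module _ (T : Filling) where
  private
    D = shape T
    f = fill T

  cell-above : ∀ {k i j} → k ≤ i → Cell D i j → Cell D k j
  cell-above k≤i (i<n , j<len) = ≤-<-trans k≤i i<n , <-≤-trans j<len (len-mono D k≤i)

  cell-left : ∀ {i j j′} → j′ < j → Cell D i j → Cell D i j′
  cell-left j′<j (i<n , j<len) = i<n , <-trans j′<j j<len

  column-of-cell : ∀ {i j} → Cell D i j → j < ncols D
  column-of-cell (_ , j<len) = <-≤-trans j<len (len-mono D z≤n)

  topmostOne-atOrAbove : ∀ {i j} → Cell D i j → f i j ≡ true →
                         ∃[ k ] (k ≤ i × TopmostOne T k j)
  topmostOne-atOrAbove {i} {j} c fij with ∃-least-true (λ r → f r j) i fij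
  ... | k , k≤i , fkj , below = k , k≤i , cell-above k≤i c , fkj , below

  arrow-onOrBelowOne : ∀ {i j} → Arrow T i j → ∃[ r ] (r ≤ i × f r j ≡ true)
  arrow-onOrBelowOne {i} (inj₁ (_ , fij , _))                 = i , ≤-refl , fij
  arrow-onOrBelowOne (inj₂ ((_ , _ , (r , r<i , frj)) , _)) = r , <⇒≤ r<i , frj

  arrowNorthwestOf⇔oneLeftAbove : ∀ {i j} → Cell D i j →
    ArrowNorthwestOf T i j ⇔ (∃[ r ] (r < i × OneLeft T r j))
  arrowNorthwestOf⇔oneLeftAbove {i} {j} c = mk⇔ to from
    where
    to : ArrowNorthwestOf T i j → ∃[ r ] (r < i × OneLeft T r j)
    to (i′ , j′ , i′<i , j′<j , arrow) with arrow-onOrBelowOne arrow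
    ... | r , r≤i′ , frj′ = r , ≤-<-trans r≤i′ i′<i , j′ , j′<j , frj′

    from : ∃[ r ] (r < i × OneLeft T r j) → ArrowNorthwestOf T i j
    from (r , r<i , j′ , j′<j , frj′)
      with topmostOne-atOrAbove (cell-left j′<j (cell-above (<⇒≤ r<i) c)) frj′
    ... | k , k≤r , up = k , j′ , ≤-<-trans k≤r r<i , j′<j , inj₁ up

  cRestrictedZero⇔oneLeftAbove : IsPermutationTableau T → ∀ {i j r} → UpArrow T i j →
    CRestrictedZero T r j ⇔ (r < i × OneLeft T r j)
  cRestrictedZero⇔oneLeftAbove P {i} {j} {r} (c , fij , zeroAbove) = mk⇔ to from
    where
    open IsPermutationTableau P

    to : CRestrictedZero T r j → r < i × OneLeft T r j
    to (crj , frj , left) with <-cmp r i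
    ... | tri< r<i _ _  = r<i , left
    ... | tri≈ _ refl _ with () ← trans (sym fij) frj
    ... | tri> _ _ i<r  = ⊥-elim (no-bad-zero r j crj frj (i , i<r , fij) left)

    from : r < i × OneLeft T r j → CRestrictedZero T r j
    from (r<i , left) = cell-above (<⇒≤ r<i) c , zeroAbove r r<i , left

lemma4p2 : (T : Filling) → IsPermutationTableau T →
           ∀ (i j : ℕ) → UpArrow T i j →
           (UnrestrictedColumn T j ⇔ (¬ ArrowNorthwestOf T i j))
lemma4p2 T P i j up@(c , _) = mk⇔ unrestricted⇒noArrow noArrow⇒unrestricted
  where
  open Equivalence

  unrestricted⇒noArrow : UnrestrictedColumn T j → ¬ ArrowNorthwestOf T i j
  unrestricted⇒noArrow (_ , noCRestricted) nw
    with r , r<i , left ← to (arrowNorthwestOf⇔oneLeftAbove T c) nw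
    = noCRestricted r (from (cRestrictedZero⇔oneLeftAbove T P up) (r<i , left))

  noArrow⇒unrestricted : ¬ ArrowNorthwestOf T i j → UnrestrictedColumn T j
  noArrow⇒unrestricted noArrow = column-of-cell T c , λ r cr →
    noArrow (from (arrowNorthwestOf⇔oneLeftAbove T c)
                  (r , to (cRestrictedZero⇔oneLeftAbove T P up) cr))
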